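{- The calculus $\mathtt{UTS}^1_0+\mathtt{K4}$ does not admit cut-elimination: the sequent $\vdash\Diamond(\Box P\otimes\overline{P}),\Box P$ is derivable using cut but has no cut-free derivation.
   Context: $\mathtt{UTS}^1_0$ is first-order affine logic (one-sided sequent calculus with initial sequents $\vdash\Gamma,P,\overline{P}$ and rules for $\oplus$, $\&$ (additive conjunction), $⅋$ (multiplicative disjunction), $\otimes$, $\forall$, $\exists$) in a language with self-referential $\lambda$-terms, extended with disquotational truth rules: from $\vdash\Gamma,A(t)$ infer $\vdash\Gamma,\mathsf{S}^1_0(\lambda xA,t)$ and from $\vdash\Gamma,\overline{A}(t)$ infer $\vdash\Gamma,\overline{\mathsf{S}^1_0}(\lambda xA,t)$. $\mathtt{UTS}^1_0+\mathtt{K4}$ adds a modality $\Box$ with dual $\Diamond$ and the rules: (nec) from $\vdash\Diamond\Gamma,\Gamma,A$ infer $\vdash\Delta,\Diamond\Gamma,\Box A$; ($\Box\otimes$) from $\vdash\Diamond\Gamma,\Delta,A$ and $\vdash\Diamond\Gamma,\Theta,B$ infer $\vdash\Diamond\Gamma,\Delta,\Theta,A\otimes B$; and Cut: from $\vdash\Gamma,A$ and $\vdash\Delta,\overline{A}$ infer $\vdash\Gamma,\Delta$. -}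

module Defs where

open import Data.Bool using (Bool; true; false; if_then_else_)
open import Data.Nat using (ℕ; zero; suc; _<ᵇ_; _≡ᵇ_; pred)
open import Data.List using (List; []; _∷_; _++_; map; [_])
open import Data.List.Relation.Binary.Permutation.Propositional using (_↭_)
open import Data.Product using (_×_)
open import Relation.Nullary using (¬_)

-- Language of UTS^1_0 + K4 (negation normal form, de Bruijn indices).  Self-reference arises since λ-terms
-- may be fed to S together with any term, including themselves.

infixr 6 _⊗_ _⅋_ _&_ _⊕_

mutual
  data Term : Set where
    var : ℕ → Term
    lam : Fm → Term

  data Fm : Set where
    P⁺ P⁻ : ℕ → List Term → Fm
    S⁺ S⁻ : Term → Term → Fm
    _⊗_ _⅋_ _&_ _⊕_ : Fm → Fm → Fm
    ∀′ ∃′ : Fm → Fm                -- binds index 0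
    □ ◇ : Fm → Fm

dual : Fm → Fm
dual (P⁺ p ts) = P⁻ p ts
dual (P⁻ p ts) = P⁺ p ts
dual (S⁺ s t) = S⁻ s t
dual (S⁻ s t) = S⁺ s t
dual (A ⊗ B) = dual A ⅋ dual B
dual (A ⅋ B) = dual A ⊗ dual B
dual (A & B) = dual A ⊕ dual B
dual (A ⊕ B) = dual A & dual B
dual (∀′ A) = ∃′ (dual A)
dual (∃′ A) = ∀′ (dual A)
dual (□ A) = ◇ (dual A)
dual (◇ A) = □ (dual A)

mutual
  shiftT : ℕ → Term → Term
  shiftT c (var n) = if n <ᵇ c then var n else var (suc n)
  shiftT c (lam A) = lam (shiftF (suc c) A)

  shiftTs : ℕ → List Term → List Term
  shiftTs c [] = []
  shiftTs c (t ∷ ts) = shiftT c t ∷ shiftTs c ts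

  shiftF : ℕ → Fm → Fm
  shiftF c (P⁺ p ts) = P⁺ p (shiftTs c ts)
  shiftF c (P⁻ p ts) = P⁻ p (shiftTs c ts)
  shiftF c (S⁺ s t) = S⁺ (shiftT c s) (shiftT c t)
  shiftF c (S⁻ s t) = S⁻ (shiftT c s) (shiftT c t)
  shiftF c (A ⊗ B) = shiftF c A ⊗ shiftF c B
  shiftF c (A ⅋ B) = shiftF c A ⅋ shiftF c B
  shiftF c (A & B) = shiftF c A & shiftF c B
  shiftF c (A ⊕ B) = shiftF c A ⊕ shiftF c B
  shiftF c (∀′ A) = ∀′ (shiftF (suc c) A)
  shiftF c (∃′ A) = ∃′ (shiftF (suc c) A)
  shiftF c (□ A) = □ (shiftF c A)
  shiftF c (◇ A) = ◇ (shiftF c A)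

mutual
  substT : ℕ → Term → Term → Term
  substT c u (var n) =
    if n <ᵇ c then var n else (if n ≡ᵇ c then u else var (pred n))
  substT c u (lam A) = lam (substF (suc c) (shiftT 0 u) A)

  substTs : ℕ → Term → List Term → List Term
  substTs c u [] = []
  substTs c u (t ∷ ts) = substT c u t ∷ substTs c u ts

  substF : ℕ → Term → Fm → Fm
  substF c u (P⁺ p ts) = P⁺ p (substTs c u ts)
  substF c u (P⁻ p ts) = P⁻ p (substTs c u ts)
  substF c u (S⁺ s t) = S⁺ (substT c u s) (substT c u t)
  substF c u (S⁻ s t) = S⁻ (substT c u s) (substT c u t)
  substF c u (A ⊗ B) = substF c u A ⊗ substF c u B
  substF c u (A ⅋ B) = substF c u A ⅋ substF c u B
  substF c u (A & B) = substF c u A & substF c u B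
  substF c u (A ⊕ B) = substF c u A ⊕ substF c u B
  substF c u (∀′ A) = ∀′ (substF (suc c) (shiftT 0 u) A)
  substF c u (∃′ A) = ∃′ (substF (suc c) (shiftT 0 u) A)
  substF c u (□ A) = □ (substF c u A)
  substF c u (◇ A) = ◇ (substF c u A)

_⟨_⟩ : Fm → Term → Fm
A ⟨ t ⟩ = substF 0 t A

◇* : List Fm → List Fm
◇* = map ◇

-- The calculus UTS^1_0 + K4.  Sequents are lists taken up to
-- permutation (exchange rule).  The flag says whether Cut is allowed.

data ⊢[_]_ : Bool → List Fm → Set where
  exch   : ∀ {cut} {Γ Δ} → Γ ↭ Δ → ⊢[ cut ] Γ → ⊢[ cut ] Δ
  initP  : ∀ {cut} Γ p ts → ⊢[ cut ] (Γ ++ P⁺ p ts ∷ P⁻ p ts ∷ [])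
  initS  : ∀ {cut} Γ s t → ⊢[ cut ] (Γ ++ S⁺ s t ∷ S⁻ s t ∷ [])
  ⊕₁     : ∀ {cut} {Γ A} B → ⊢[ cut ] (Γ ++ [ A ]) → ⊢[ cut ] (Γ ++ [ A ⊕ B ])
  ⊕₂     : ∀ {cut} {Γ B} A → ⊢[ cut ] (Γ ++ [ B ]) → ⊢[ cut ] (Γ ++ [ A ⊕ B ])
  &I     : ∀ {cut} {Γ A B} → ⊢[ cut ] (Γ ++ [ A ]) → ⊢[ cut ] (Γ ++ [ B ])
           → ⊢[ cut ] (Γ ++ [ A & B ])
  ⅋I     : ∀ {cut} {Γ A B} → ⊢[ cut ] (Γ ++ A ∷ B ∷ []) → ⊢[ cut ] (Γ ++ [ A ⅋ B ])
  ⊗I     : ∀ {cut} {Γ Δ A B} → ⊢[ cut ] (Γ ++ [ A ]) → ⊢[ cut ] (Δ ++ [ B ])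
           → ⊢[ cut ] (Γ ++ Δ ++ [ A ⊗ B ])
  -- ∀: eigenvariable = index 0, fresh because Γ is shifted
  ∀I     : ∀ {cut} {Γ A} → ⊢[ cut ] (map (shiftF 0) Γ ++ [ A ]) → ⊢[ cut ] (Γ ++ [ ∀′ A ])
  ∃I     : ∀ {cut} {Γ A} t → ⊢[ cut ] (Γ ++ [ A ⟨ t ⟩ ]) → ⊢[ cut ] (Γ ++ [ ∃′ A ])
  SI     : ∀ {cut} {Γ A t} → ⊢[ cut ] (Γ ++ [ A ⟨ t ⟩ ]) → ⊢[ cut ] (Γ ++ [ S⁺ (lam A) t ])
  S̄I     : ∀ {cut} {Γ A t} → ⊢[ cut ] (Γ ++ [ (dual A) ⟨ t ⟩ ])
           → ⊢[ cut ] (Γ ++ [ S⁻ (lam A) t ])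
  nec    : ∀ {cut} {Γ A} Δ → ⊢[ cut ] (◇* Γ ++ Γ ++ [ A ]) → ⊢[ cut ] (Δ ++ ◇* Γ ++ [ □ A ])
  □⊗     : ∀ {cut} {Γ Δ Θ A B} → ⊢[ cut ] (◇* Γ ++ Δ ++ [ A ]) → ⊢[ cut ] (◇* Γ ++ Θ ++ [ B ])
           → ⊢[ cut ] (◇* Γ ++ Δ ++ Θ ++ [ A ⊗ B ])
  cutR   : ∀ {Γ Δ} A → ⊢[ true ] (Γ ++ [ A ]) → ⊢[ true ] (Δ ++ [ dual A ])
           → ⊢[ true ] (Γ ++ Δ)

Derivable CutFreeDerivable : List Fm → Set
Derivable Γ = ⊢[ true ] Γ
CutFreeDerivable Γ = ⊢[ false ] Γ

-- With cut: the λ-term δ = λx (◇ S̄(x,x) ⅋ C) gives a sentence L = S(δ,δ) whose truth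
-- rules let it be introduced from ◇L̄ ⅋ C, and L̄ from □L ⊗ C̄.  With these, ⊢ ◇L̄, □C
-- and ⊢ ◇(□C ⊗ C̄), □L are derivable without cut, and a cut on □L joins them.
-- Without cut: read □ and ◇ as the identity, every P as false and both S and S̄ as true.
-- In this one-world model all rules but Cut preserve the truth of some formula of the
-- sequent (Cut fails since S is glutty), yet no formula of ◇(□P ⊗ P̄), □P is true.
module Submission where

open import Defs
open import Data.Bool using (true; false)
open import Data.Empty using (⊥)
open import Data.Nat using (ℕ; zero; suc; _<ᵇ_; _≡ᵇ_)
open import Data.List using (List; []; _∷_; _++_; map; [_])
open import Data.List.Properties using (++-assoc)
open import Data.List.Relation.Unary.Any as Any using (Any; here; there)
open import Data.List.Relation.Unary.Any.Properties using (++⁺ˡ; ++⁺ʳ; ++⁻; map⁺; map⁻)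
open import Data.List.Relation.Binary.Permutation.Propositional using (↭-refl; prep; swap)
open import Data.List.Relation.Binary.Permutation.Propositional.Properties using (Any-resp-↭; shift)
open import Data.Product using (_×_; _,_)
open import Data.Sum as Sum using (_⊎_; inj₁; inj₂)
open import Data.Unit using (⊤; tt)
open import Function using (id)
open import Relation.Nullary using (¬_)
open import Relation.Binary.PropositionalEquality using (_≡_; refl; sym; trans; cong; cong₂; subst)

≮ᵇ⇒suc≮ᵇ : ∀ n c → (n <ᵇ c) ≡ false → (suc n <ᵇ c) ≡ false
≮ᵇ⇒suc≮ᵇ n       zero    _  = refl
≮ᵇ⇒suc≮ᵇ (suc n) (suc c) eq = ≮ᵇ⇒suc≮ᵇ n c eq

≮ᵇ⇒suc≢ᵇ : ∀ n c → (n <ᵇ c) ≡ false → (suc n ≡ᵇ c) ≡ false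
≮ᵇ⇒suc≢ᵇ n       zero    _  = refl
≮ᵇ⇒suc≢ᵇ (suc n) (suc c) eq = ≮ᵇ⇒suc≢ᵇ n c eq

mutual
  substT-shiftT : ∀ c u t → substT c u (shiftT c t) ≡ t
  substT-shiftT c u (var n) with n <ᵇ c in eq
  ... | true  rewrite eq = refl
  ... | false rewrite ≮ᵇ⇒suc≮ᵇ n c eq | ≮ᵇ⇒suc≢ᵇ n c eq = refl
  substT-shiftT c u (lam A) = cong lam (substF-shiftF (suc c) (shiftT 0 u) A)

  substTs-shiftTs : ∀ c u ts → substTs c u (shiftTs c ts) ≡ ts
  substTs-shiftTs c u []       = refl
  substTs-shiftTs c u (t ∷ ts) = cong₂ _∷_ (substT-shiftT c u t) (substTs-shiftTs c u ts)

  substF-shiftF : ∀ c u A → substF c u (shiftF c A) ≡ A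
  substF-shiftF c u (P⁺ p ts) = cong (P⁺ p) (substTs-shiftTs c u ts)
  substF-shiftF c u (P⁻ p ts) = cong (P⁻ p) (substTs-shiftTs c u ts)
  substF-shiftF c u (S⁺ s t)  = cong₂ S⁺ (substT-shiftT c u s) (substT-shiftT c u t)
  substF-shiftF c u (S⁻ s t)  = cong₂ S⁻ (substT-shiftT c u s) (substT-shiftT c u t)
  substF-shiftF c u (A ⊗ B)   = cong₂ _⊗_ (substF-shiftF c u A) (substF-shiftF c u B)
  substF-shiftF c u (A ⅋ B)   = cong₂ _⅋_ (substF-shiftF c u A) (substF-shiftF c u B)
  substF-shiftF c u (A & B)   = cong₂ _&_ (substF-shiftF c u A) (substF-shiftF c u B)
  substF-shiftF c u (A ⊕ B)   = cong₂ _⊕_ (substF-shiftF c u A) (substF-shiftF c u B)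
  substF-shiftF c u (∀′ A)    = cong ∀′ (substF-shiftF (suc c) (shiftT 0 u) A)
  substF-shiftF c u (∃′ A)    = cong ∃′ (substF-shiftF (suc c) (shiftT 0 u) A)
  substF-shiftF c u (□ A)     = cong □ (substF-shiftF c u A)
  substF-shiftF c u (◇ A)     = cong ◇ (substF-shiftF c u A)

dual-shiftF : ∀ c A → dual (shiftF c A) ≡ shiftF c (dual A)
dual-shiftF c (P⁺ p ts) = refl
dual-shiftF c (P⁻ p ts) = refl
dual-shiftF c (S⁺ s t)  = refl
dual-shiftF c (S⁻ s t)  = refl
dual-shiftF c (A ⊗ B)   = cong₂ _⅋_ (dual-shiftF c A) (dual-shiftF c B)
dual-shiftF c (A ⅋ B)   = cong₂ _⊗_ (dual-shiftF c A) (dual-shiftF c B)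
dual-shiftF c (A & B)   = cong₂ _⊕_ (dual-shiftF c A) (dual-shiftF c B)
dual-shiftF c (A ⊕ B)   = cong₂ _&_ (dual-shiftF c A) (dual-shiftF c B)
dual-shiftF c (∀′ A)    = cong ∃′ (dual-shiftF (suc c) A)
dual-shiftF c (∃′ A)    = cong ∀′ (dual-shiftF (suc c) A)
dual-shiftF c (□ A)     = cong ◇ (dual-shiftF c A)
dual-shiftF c (◇ A)     = cong □ (dual-shiftF c A)

module SelfReference (C : Fm) where

  body : Fm
  body = ◇ (S⁻ (var 0) (var 0)) ⅋ shiftF 0 C

  δ : Term
  δ = lam body

  L : Fm
  L = S⁺ δ δ

  X : Fm
  X = □ C ⊗ dual C

  L-unfold : body ⟨ δ ⟩ ≡ ◇ (dual L) ⅋ C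
  L-unfold = cong (◇ (dual L) ⅋_) (substF-shiftF 0 δ C)

  dual-L-unfold : dual body ⟨ δ ⟩ ≡ □ L ⊗ dual C
  dual-L-unfold = cong (□ L ⊗_)
    (trans (cong (substF 0 δ) (dual-shiftF 0 C)) (substF-shiftF 0 δ (dual C)))

  module Derivations {cut} (C-identity : ⊢[ cut ] (C ∷ dual C ∷ [])) where

    L-intro : ∀ {Γ} → ⊢[ cut ] (Γ ++ [ ◇ (dual L) ⅋ C ]) → ⊢[ cut ] (Γ ++ [ L ])
    L-intro {Γ} d = SI (subst (λ A → ⊢[ cut ] (Γ ++ [ A ])) (sym L-unfold) d)

    dual-L-intro : ∀ {Γ} → ⊢[ cut ] (Γ ++ [ □ L ⊗ dual C ]) → ⊢[ cut ] (Γ ++ [ dual L ])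
    dual-L-intro {Γ} d = S̄I (subst (λ A → ⊢[ cut ] (Γ ++ [ A ])) (sym dual-L-unfold) d)

    □L-identity : ∀ Δ → ⊢[ cut ] ((Δ ++ [ ◇ (dual L) ]) ++ [ □ L ])
    □L-identity Δ = subst ⊢[ cut ]_ (sym (++-assoc Δ _ _))
      (nec {Γ = [ dual L ]} Δ (exch (prep _ (swap _ _ ↭-refl)) (initS [ ◇ (dual L) ] δ δ)))

    dual-L-from-◇dual-L : ∀ Δ → ⊢[ cut ] ((Δ ++ ◇ (dual L) ∷ [ C ]) ++ [ dual L ])
    dual-L-from-◇dual-L Δ = dual-L-intro {Γ = Δ ++ ◇ (dual L) ∷ [ C ]}
      (subst ⊢[ cut ]_ (trans (++-assoc Δ _ _) (sym (++-assoc Δ _ _)))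
        (⊗I {Γ = Δ ++ [ ◇ (dual L) ]} {Δ = [ C ]} (□L-identity Δ) C-identity))

    □C-from-◇dual-L : ⊢[ cut ] (◇ (dual L) ∷ □ C ∷ [])
    □C-from-◇dual-L =
      nec {Γ = [ dual L ]} [] (exch (prep _ (swap _ _ ↭-refl)) (dual-L-from-◇dual-L []))

    □C-from-◇X-◇dual-L : ⊢[ cut ] (◇ X ∷ ◇ (dual L) ∷ □ C ∷ [])
    □C-from-◇X-◇dual-L = nec {Γ = X ∷ [ dual L ]} []
      (exch (prep _ (swap _ _ (swap _ _ ↭-refl))) (dual-L-from-◇dual-L (◇ X ∷ [ X ])))

    □L-from-◇X : ⊢[ cut ] (◇ X ∷ □ L ∷ [])
    □L-from-◇X = nec {Γ = [ X ]} [] (L-intro {Γ = ◇ X ∷ [ X ]} (⅋I {Γ = ◇ X ∷ [ X ]}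
      (exch (prep _ (shift X (◇ (dual L) ∷ [ C ]) []))
        (⊗I {Γ = ◇ X ∷ [ ◇ (dual L) ]} {Δ = [ C ]} □C-from-◇X-◇dual-L C-identity))))

cutNeededSequent : Fm → List Fm
cutNeededSequent C = ◇ (□ C ⊗ dual C) ∷ □ C ∷ []

cutNeededSequent-derivable : ∀ C → Derivable (C ∷ dual C ∷ []) → Derivable (cutNeededSequent C)
cutNeededSequent-derivable C C-identity = cutR {Γ = [ ◇ X ]} {Δ = [ □ C ]} (□ L)
  □L-from-◇X (exch (swap _ _ ↭-refl) □C-from-◇dual-L)
  where open SelfReference C
        open Derivations C-identity

Holds : Fm → Set
Holds (P⁺ _ _) = ⊥
Holds (P⁻ _ _) = ⊤
Holds (S⁺ _ _) = ⊤
Holds (S⁻ _ _) = ⊤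
Holds (A ⊗ B)  = Holds A × Holds B
Holds (A ⅋ B)  = Holds A ⊎ Holds B
Holds (A & B)  = Holds A × Holds B
Holds (A ⊕ B)  = Holds A ⊎ Holds B
Holds (∀′ A)   = Holds A
Holds (∃′ A)   = Holds A
Holds (□ A)    = Holds A
Holds (◇ A)    = Holds A

Valid : List Fm → Set
Valid = Any Holds

Holds-shiftF : ∀ c A → Holds (shiftF c A) ≡ Holds A
Holds-shiftF c (P⁺ _ _) = refl
Holds-shiftF c (P⁻ _ _) = refl
Holds-shiftF c (S⁺ _ _) = refl
Holds-shiftF c (S⁻ _ _) = refl
Holds-shiftF c (A ⊗ B)  = cong₂ _×_ (Holds-shiftF c A) (Holds-shiftF c B)
Holds-shiftF c (A ⅋ B)  = cong₂ _⊎_ (Holds-shiftF c A) (Holds-shiftF c B)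
Holds-shiftF c (A & B)  = cong₂ _×_ (Holds-shiftF c A) (Holds-shiftF c B)
Holds-shiftF c (A ⊕ B)  = cong₂ _⊎_ (Holds-shiftF c A) (Holds-shiftF c B)
Holds-shiftF c (∀′ A)   = Holds-shiftF (suc c) A
Holds-shiftF c (∃′ A)   = Holds-shiftF (suc c) A
Holds-shiftF c (□ A)    = Holds-shiftF c A
Holds-shiftF c (◇ A)    = Holds-shiftF c A

Holds-substF : ∀ c u A → Holds (substF c u A) ≡ Holds A
Holds-substF c u (P⁺ _ _) = refl
Holds-substF c u (P⁻ _ _) = refl
Holds-substF c u (S⁺ _ _) = refl
Holds-substF c u (S⁻ _ _) = refl
Holds-substF c u (A ⊗ B)  = cong₂ _×_ (Holds-substF c u A) (Holds-substF c u B)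
Holds-substF c u (A ⅋ B)  = cong₂ _⊎_ (Holds-substF c u A) (Holds-substF c u B)
Holds-substF c u (A & B)  = cong₂ _×_ (Holds-substF c u A) (Holds-substF c u B)
Holds-substF c u (A ⊕ B)  = cong₂ _⊎_ (Holds-substF c u A) (Holds-substF c u B)
Holds-substF c u (∀′ A)   = Holds-substF (suc c) (shiftT 0 u) A
Holds-substF c u (∃′ A)   = Holds-substF (suc c) (shiftT 0 u) A
Holds-substF c u (□ A)    = Holds-substF c u A
Holds-substF c u (◇ A)    = Holds-substF c u A

Valid-++⁻ : ∀ Γ {A} → Valid (Γ ++ [ A ]) → Valid Γ ⊎ Holds A
Valid-++⁻ Γ v with ++⁻ Γ v
... | inj₁ γ        = inj₁ γ
... | inj₂ (here a) = inj₂ a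

Valid-++⁺ : ∀ Γ {A} → Valid Γ ⊎ Holds A → Valid (Γ ++ [ A ])
Valid-++⁺ Γ (inj₁ γ) = ++⁺ˡ γ
Valid-++⁺ Γ (inj₂ a) = ++⁺ʳ Γ (here a)

Valid-principal : ∀ Γ {A B} → (Holds A → Holds B) → Valid (Γ ++ [ A ]) → Valid (Γ ++ [ B ])
Valid-principal Γ f v = Valid-++⁺ Γ (Sum.map₂ f (Valid-++⁻ Γ v))

Valid-⊗ : ∀ Γ Δ {A B} → Valid (Γ ++ [ A ]) → Valid (Δ ++ [ B ]) → Valid (Γ ++ Δ ++ [ A ⊗ B ])
Valid-⊗ Γ Δ v w with Valid-++⁻ Γ v | Valid-++⁻ Δ w
... | inj₁ γ | _      = ++⁺ˡ γ
... | inj₂ _ | inj₁ δ = ++⁺ʳ Γ (++⁺ˡ δ)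
... | inj₂ a | inj₂ b = ++⁺ʳ Γ (++⁺ʳ Δ (here (a , b)))

cutFree-sound : ∀ {Γ} → CutFreeDerivable Γ → Valid Γ
cutFree-sound (exch π d)             = Any-resp-↭ π (cutFree-sound d)
cutFree-sound (initP Γ p ts)         = ++⁺ʳ Γ (there (here tt))
cutFree-sound (initS Γ s t)          = ++⁺ʳ Γ (here tt)
cutFree-sound (⊕₁ {Γ = Γ} B d)       = Valid-principal Γ inj₁ (cutFree-sound d)
cutFree-sound (⊕₂ {Γ = Γ} A d)       = Valid-principal Γ inj₂ (cutFree-sound d)
cutFree-sound (&I {Γ = Γ} d e) with Valid-++⁻ Γ (cutFree-sound d) | Valid-++⁻ Γ (cutFree-sound e)
... | inj₁ γ | _      = ++⁺ˡ γ
... | inj₂ _ | inj₁ γ = ++⁺ˡ γ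
... | inj₂ a | inj₂ b = ++⁺ʳ Γ (here (a , b))
cutFree-sound (⅋I {Γ = Γ} d) with ++⁻ Γ (cutFree-sound d)
... | inj₁ γ                 = ++⁺ˡ γ
... | inj₂ (here a)          = ++⁺ʳ Γ (here (inj₁ a))
... | inj₂ (there (here b))  = ++⁺ʳ Γ (here (inj₂ b))
cutFree-sound (⊗I {Γ = Γ} {Δ} d e)   = Valid-⊗ Γ Δ (cutFree-sound d) (cutFree-sound e)
cutFree-sound (∀I {Γ = Γ} d) with Valid-++⁻ (map (shiftF 0) Γ) (cutFree-sound d)
... | inj₁ γ = ++⁺ˡ (Any.map (λ {A} → subst id (Holds-shiftF 0 A)) (map⁻ γ))
... | inj₂ a = ++⁺ʳ Γ (here a)
cutFree-sound (∃I {Γ = Γ} {A} t d)   = Valid-principal Γ (subst id (Holds-substF 0 t A)) (cutFree-sound d)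
cutFree-sound (SI {Γ = Γ} d)         = ++⁺ʳ Γ (here tt)
cutFree-sound (S̄I {Γ = Γ} d)         = ++⁺ʳ Γ (here tt)
cutFree-sound (nec {Γ = Γ} Δ d) with ++⁻ (◇* Γ) (cutFree-sound d)
... | inj₁ ◇γ = ++⁺ʳ Δ (++⁺ˡ ◇γ)
... | inj₂ v with Valid-++⁻ Γ v
...   | inj₁ γ = ++⁺ʳ Δ (++⁺ˡ (map⁺ γ))
...   | inj₂ a = ++⁺ʳ Δ (++⁺ʳ (◇* Γ) (here a))
cutFree-sound (□⊗ {Γ = Γ} {Δ} {Θ} d e) with ++⁻ (◇* Γ) (cutFree-sound d) | ++⁻ (◇* Γ) (cutFree-sound e)
... | inj₁ ◇γ | _      = ++⁺ˡ ◇γ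
... | inj₂ _  | inj₁ ◇γ = ++⁺ˡ ◇γ
... | inj₂ v  | inj₂ w  = ++⁺ʳ (◇* Γ) (Valid-⊗ Δ Θ v w)

cutNeededSequent-not-cutFree : ∀ C → ¬ Holds C → ¬ CutFreeDerivable (cutNeededSequent C)
cutNeededSequent-not-cutFree C ¬C d with cutFree-sound d
... | here (c , _)    = ¬C c
... | there (here c)  = ¬C c

mainTheorem8 : (p : ℕ) (ts : List Term) →
    Derivable (◇ (□ (P⁺ p ts) ⊗ P⁻ p ts) ∷ □ (P⁺ p ts) ∷ [])
    × ¬ CutFreeDerivable (◇ (□ (P⁺ p ts) ⊗ P⁻ p ts) ∷ □ (P⁺ p ts) ∷ [])
mainTheorem8 p ts =
    cutNeededSequent-derivable (P⁺ p ts) (initP [] p ts)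
  , cutNeededSequent-not-cutFree (P⁺ p ts) λ ()
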